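{- Let $q$ be a prime power, let $n\ge 2$ be an integer and let $f:\mathbb{F}_q\to\mathbb{F}_q$ be $f(x)=x^n$. Let $q^*(n)$ be the largest divisor of $q-1$ that is relatively prime to $n$, and let $\hat r(n)$ be the least positive integer with $q^*(n)\mid n^{\hat r(n)}-1$. For a positive integer $r$ let $\mathcal{P}(r,q)$ be the number of $r$-periodic points of $f$. Then for every integer $M\ge \hat r(n)$, $$\sum_{r=1}^{M}\mathcal{P}(r,q)=q^*(n)+1.$$
   Context: $f^{\circ r}$ denotes the $r$-th iterate of $f$. A point $x_0$ is an $r$-periodic point of $f$ if $r$ is the least positive integer with $f^{\circ r}(x_0)=x_0$. -}

module Defs where

open import Level using (0ℓ)
open import Algebra.Bundles using (CommutativeRing)
open import Data.Nat using (ℕ; zero; suc; _+_; _∸_; _^_; _<_; _≤_; s≤s; z≤n)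
open import Data.Nat.Properties using (≤-refl)
open import Data.Nat.Divisibility using (_∣_)
open import Data.Nat.Coprimality using (Coprime)
open import Data.Fin using (Fin)
open import Data.List using (List; length; filter; sum; map; upTo)
open import Data.Fin.Base using () renaming (toℕ to toℕ)
open import Data.List.Base using ()
open import Data.Product using (Σ; _×_; _,_; ∃)
open import Relation.Nullary using (¬_; Dec; yes; no)
open import Relation.Nullary.Decidable using (_×-dec_; _→-dec_; ¬?)
open import Relation.Binary.PropositionalEquality using (_≡_)
open import Data.Nat.Properties using (_<?_)
import Data.Nat.Properties
import Data.Sum
import Relation.Binary.PropositionalEquality
import Data.List

-- A finite field: a commutative ring (setoid equality) with 1 ≠ 0 in which
-- every nonzero element is invertible, with decidable equality, together with
-- a bijective enumeration of its elements by Fin q (q = number of elements).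
record FiniteField : Set₁ where
  field
    commRing : CommutativeRing 0ℓ 0ℓ
  open CommutativeRing commRing public
  field
    1≉0     : ¬ (1# ≈ 0#)
    inverse : ∀ x → ¬ (x ≈ 0#) → Σ Carrier λ y → (x * y) ≈ 1#
    _≟_     : ∀ x y → Dec (x ≈ y)
    size    : ℕ
    enum    : Fin size → Carrier
    enum-injective  : ∀ i j → enum i ≈ enum j → i ≡ j
    enum-surjective : ∀ x → Σ (Fin size) λ i → enum i ≈ x

module _ (F : FiniteField) where
  open FiniteField F

  pow : Carrier → ℕ → Carrier
  pow x zero    = 1#
  pow x (suc n) = x * pow x n

  powerMap : ℕ → Carrier → Carrier
  powerMap n x = pow x n

  iterate : (Carrier → Carrier) → ℕ → Carrier → Carrier
  iterate f zero    x = x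
  iterate f (suc r) x = f (iterate f r x)

  IsPeriodicPoint : (Carrier → Carrier) → ℕ → Carrier → Set
  IsPeriodicPoint f r x =
    (0 < r) × (iterate f r x ≈ x) × (∀ s → s < r → 0 < s → ¬ (iterate f s x ≈ x))

  private
    allBelow? : (P : ℕ → Set) → (∀ s → Dec (P s)) → ∀ r → Dec (∀ s → s < r → P s)
    allBelow? P P? zero = yes λ s ()
    allBelow? P P? (suc r) with allBelow? P P? r | P? r
    ... | no ¬h | _ = no λ h → ¬h (λ s s<r → h s (Data.Nat.Properties.m<n⇒m<1+n s<r))
    ... | yes h | no ¬p = no λ h' → ¬p (h' r ≤-refl)
    ... | yes h | yes p = yes λ s s<1+r → helper s s<1+r
      where
      helper : ∀ s → s < suc r → P s
      helper s s<1+r with Data.Nat.Properties.m<1+n⇒m<n∨m≡n s<1+r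
      ... | Data.Sum.inj₁ s<r = h s s<r
      ... | Data.Sum.inj₂ Relation.Binary.PropositionalEquality.refl = p

  isPeriodicPoint? : ∀ f r x → Dec (IsPeriodicPoint f r x)
  isPeriodicPoint? f r x =
    (0 <? r) ×-dec (iterate f r x ≟ x)
      ×-dec allBelow? (λ s → 0 < s → ¬ (iterate f s x ≈ x)) (λ s → (0 <? s) →-dec ¬? (iterate f s x ≟ x)) r

  numPeriodicPoints : (Carrier → Carrier) → ℕ → ℕ
  numPeriodicPoints f r =
    length (filter (λ i → isPeriodicPoint? f r (enum i)) (Data.List.allFin size))

sumFrom1 : ℕ → (ℕ → ℕ) → ℕ
sumFrom1 zero    g = 0
sumFrom1 (suc M) g = sumFrom1 M g + g (suc M)

IsLargestCoprimeDivisor : ℕ → ℕ → ℕ → Set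
IsLargestCoprimeDivisor m n d =
  (d ∣ m) × Coprime d n × (∀ e → e ∣ m → Coprime e n → e ≤ d)

IsLeastOrder : ℕ → ℕ → ℕ → Set
IsLeastOrder d n r =
  (0 < r) × (d ∣ (n ^ r ∸ 1)) × (∀ s → 0 < s → d ∣ (n ^ s ∸ 1) → r ≤ s)

module Submission where

-- Periodic points of the power map f(x) = xⁿ on a finite field F with q
-- elements; m = q - 1 = #F*, q* is the largest divisor of m coprime to n.
-- Σ_{r=1}^{M} 𝒫(r, q) counts each x once for every least period of x in
-- [1, M]: since least periods are unique, x contributes 1 if it returns to
-- itself within M steps and 0 otherwise.  As fʳ(x) = x^(nʳ), x returns after
-- r steps iff x = 0 or x^(nʳ-1) = 1.  For x ≠ 0 Fermat adds x^m = 1, so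
-- x^gcd(nʳ-1, m) = 1, and gcd(nʳ-1, m) ∣ q* as a divisor of m coprime to n;
-- conversely q* ∣ n^r̂ - 1, so q*-th roots of unity return after r̂ ≤ M steps.
-- Thus the sum counts 0 and the q*-th roots of unity, and there are exactly
-- q* of the latter because q* ∣ m (root bound for monic polynomials applied
-- to y^q* - 1 and to the cofactor 1 + y^q* + y^(2q*) + … of y^m - 1).

open import Defs
open import Data.Nat using (ℕ; _≤_; _∸_; _+_)
open import Relation.Binary.PropositionalEquality using (_≡_)

open import Level using (Level)
import Data.Nat as ℕ
open import Data.Nat using (zero; suc; _<_; z≤n; s≤s)
import Data.Nat.Properties as ℕₚ
open import Data.Nat.Divisibility using (_∣_; divides; ∣-trans; m∣m*n; n∣m*n; ∣m+n∣m⇒∣n; ∣1⇒≡1; ∣⇒≤; 0∣⇒≡0)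
open import Data.Nat.Coprimality using (Coprime; coprime-divisor; gcd≡1⇒coprime)
open import Data.Nat.GCD using (gcd; gcd-GCD; gcd[m,n]∣m; gcd[m,n]∣n; module Bézout)
open import Data.Nat.LCM using (lcm; m∣lcm[m,n]; n∣lcm[m,n]; lcm-least; gcd*lcm)
open import Data.Fin using (Fin; zero; suc)
import Data.Fin.Properties as Finₚ
open import Data.Fin.Permutation using (Permutation; permutation; _⟨$⟩ʳ_)
open import Data.List using (List; []; _∷_; length; filter; tabulate; replicate; _++_)
open import Data.List.Properties using (length-++; length-replicate; ++-identityʳ)
open import Data.Product using (Σ; ∃; _×_; _,_; proj₁; proj₂)
open import Data.Sum using (_⊎_; inj₁; inj₂; [_,_]; [_,_]′)
import Data.Sum as Sum
open import Data.Empty using (⊥-elim)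
open import Data.Maybe using (nothing)
open import Function using (_∘_; id)
open import Relation.Nullary using (¬_; Dec; yes; no)
open import Relation.Nullary.Decidable using (¬?; decidable-stable)
open import Relation.Binary.Definitions using (tri<; tri≈; tri>)
open import Relation.Binary.PropositionalEquality as ≡ using (refl; cong; cong₂; subst; _≢_)
open import Algebra.Properties.CommutativeMonoid.Sum ℕₚ.+-0-commutativeMonoid
  using (sum; ∑-distrib-+; sum-cong-≗; sum-replicate-zero)

private
  variable
    ℓᵃ ℓᵖ ℓᵍ ℓʳ : Level
    A : Set ℓᵃ
    P : Set ℓᵖ
    Q : Set ℓᵍ
    R : Set ℓʳ

𝟙 : Dec P → ℕ
𝟙 (yes _) = 1
𝟙 (no _)  = 0

𝟙-yes : P → (P? : Dec P) → 𝟙 P? ≡ 1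
𝟙-yes p (yes _) = refl
𝟙-yes p (no ¬p) = ⊥-elim (¬p p)

𝟙-no : ¬ P → (P? : Dec P) → 𝟙 P? ≡ 0
𝟙-no ¬p (yes p) = ⊥-elim (¬p p)
𝟙-no ¬p (no _)  = refl

𝟙-mono : (P → Q) → (P? : Dec P) (Q? : Dec Q) → 𝟙 P? ≤ 𝟙 Q?
𝟙-mono P⇒Q (no _)  _       = z≤n
𝟙-mono P⇒Q (yes _) (yes _) = ℕₚ.≤-refl
𝟙-mono P⇒Q (yes p) (no ¬q) = ⊥-elim (¬q (P⇒Q p))

𝟙-cover : (P → Q ⊎ R) → (P? : Dec P) (Q? : Dec Q) (R? : Dec R) → 𝟙 P? ≤ 𝟙 Q? + 𝟙 R?
𝟙-cover P⇒Q⊎R (no _)  _       _       = z≤n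
𝟙-cover P⇒Q⊎R (yes _) (yes _) _       = s≤s z≤n
𝟙-cover P⇒Q⊎R (yes _) (no _)  (yes _) = s≤s z≤n
𝟙-cover P⇒Q⊎R (yes p) (no ¬q) (no ¬r) = ⊥-elim ([ ¬q , ¬r ] (P⇒Q⊎R p))

∑-mono : ∀ {n} {f g : Fin n → ℕ} → (∀ i → f i ≤ g i) → sum f ≤ sum g
∑-mono {zero}  f≤g = z≤n
∑-mono {suc n} f≤g = ℕₚ.+-mono-≤ (f≤g zero) (∑-mono (f≤g ∘ suc))

∑-ones : ∀ n → sum {n} (λ _ → 1) ≡ n
∑-ones zero    = refl
∑-ones (suc n) = cong suc (∑-ones n)

count : ∀ {n} {P : Fin n → Set ℓᵖ} → (∀ i → Dec (P i)) → ℕ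
count P? = sum (λ i → 𝟙 (P? i))

module _ {n} {P : Fin n → Set ℓᵖ} (P? : ∀ i → Dec (P i)) where

  count-mono : {Q : Fin n → Set ℓᵍ} (Q? : ∀ i → Dec (Q i)) → (∀ i → P i → Q i) → count P? ≤ count Q?
  count-mono Q? P⇒Q = ∑-mono (λ i → 𝟙-mono (P⇒Q i) (P? i) (Q? i))

  count-cong : {Q : Fin n → Set ℓᵍ} (Q? : ∀ i → Dec (Q i)) →
               (∀ i → P i → Q i) → (∀ i → Q i → P i) → count P? ≡ count Q?
  count-cong Q? P⇒Q Q⇒P =
    sum-cong-≗ (λ i → ℕₚ.≤-antisym (𝟙-mono (P⇒Q i) (P? i) (Q? i)) (𝟙-mono (Q⇒P i) (Q? i) (P? i)))

  count-cover : {Q : Fin n → Set ℓᵍ} {R : Fin n → Set ℓʳ} (Q? : ∀ i → Dec (Q i)) (R? : ∀ i → Dec (R i)) →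
                (∀ i → P i → Q i ⊎ R i) → count P? ≤ count Q? + count R?
  count-cover Q? R? P⇒Q⊎R = ℕₚ.≤-trans (∑-mono (λ i → 𝟙-cover (P⇒Q⊎R i) (P? i) (Q? i) (R? i)))
                                       (ℕₚ.≤-reflexive (∑-distrib-+ (λ i → 𝟙 (Q? i)) (λ i → 𝟙 (R? i))))

  count-none : (∀ i → ¬ P i) → count P? ≡ 0
  count-none ¬P = ≡.trans (sum-cong-≗ (λ i → 𝟙-no (¬P i) (P? i))) (sum-replicate-zero n)

  count-complement : count P? + count (¬? ∘ P?) ≡ n
  count-complement = ≡.trans (≡.sym (∑-distrib-+ (λ i → 𝟙 (P? i)) (λ i → 𝟙 (¬? (P? i)))))
                             (≡.trans (sum-cong-≗ exactly-one) (∑-ones n))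
    where
    exactly-one : ∀ i → 𝟙 (P? i) + 𝟙 (¬? (P? i)) ≡ 1
    exactly-one i with P? i
    ... | yes _ = refl
    ... | no _  = refl

count-≡ : ∀ {n} (j : Fin n) → count (Finₚ._≟ j) ≡ 1
count-≡ {suc n} zero    = cong suc (sum-replicate-zero n)
count-≡ {suc n} (suc j) =
  ≡.trans (count-cong (λ i → suc i Finₚ.≟ suc j) (Finₚ._≟ j) (λ i → Finₚ.suc-injective) (λ i → cong suc))
          (count-≡ j)

length-filter-tabulate : {P : A → Set ℓᵖ} (P? : ∀ x → Dec (P x)) {n : ℕ} (f : Fin n → A) →
                         length (filter P? (tabulate f)) ≡ count (P? ∘ f)
length-filter-tabulate P? {zero}  f = refl
length-filter-tabulate P? {suc n} f with P? (f zero)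
... | yes _ = cong suc (length-filter-tabulate P? (f ∘ suc))
... | no _  = length-filter-tabulate P? (f ∘ suc)

sumFrom1-cong : ∀ M {g h : ℕ → ℕ} → (∀ r → g r ≡ h r) → sumFrom1 M g ≡ sumFrom1 M h
sumFrom1-cong zero    g≡h = refl
sumFrom1-cong (suc M) g≡h = cong₂ _+_ (sumFrom1-cong M g≡h) (g≡h (suc M))

sumFrom1-∑-comm : ∀ M {n} (g : ℕ → Fin n → ℕ) →
                  sumFrom1 M (λ r → sum (g r)) ≡ sum (λ i → sumFrom1 M (λ r → g r i))
sumFrom1-∑-comm zero    {n} g = ≡.sym (sum-replicate-zero n)
sumFrom1-∑-comm (suc M)     g =
  ≡.trans (cong (_+ sum (g (suc M))) (sumFrom1-∑-comm M g))
          (≡.sym (∑-distrib-+ (λ i → sumFrom1 M (λ r → g r i)) (g (suc M))))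

module _ {Q : ℕ → Set ℓᵍ} (Q? : ∀ r → Dec (Q r)) where

  sumFrom1-𝟙-none : ∀ M → (∀ r → 0 < r → r ≤ M → ¬ Q r) → sumFrom1 M (λ r → 𝟙 (Q? r)) ≡ 0
  sumFrom1-𝟙-none zero    ¬Q = refl
  sumFrom1-𝟙-none (suc M) ¬Q =
    cong₂ _+_ (sumFrom1-𝟙-none M (λ r r>0 r≤M → ¬Q r r>0 (ℕₚ.m≤n⇒m≤1+n r≤M)))
              (𝟙-no (¬Q (suc M) (s≤s z≤n) ℕₚ.≤-refl) (Q? (suc M)))

  sumFrom1-𝟙-unique : ∀ M {r₀} → 0 < r₀ → r₀ ≤ M → Q r₀ → (∀ {r} → Q r → r ≡ r₀) →
                      sumFrom1 M (λ r → 𝟙 (Q? r)) ≡ 1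
  sumFrom1-𝟙-unique zero    {suc _} _ () _ _
  sumFrom1-𝟙-unique (suc M) {r₀} r₀>0 r₀≤1+M Qr₀ only-r₀ with r₀ ℕₚ.≟ suc M
  ... | yes refl = cong₂ _+_ (sumFrom1-𝟙-none M (λ r _ r≤M Qr → ℕₚ.1+n≰n (subst (_≤ M) (only-r₀ Qr) r≤M)))
                             (𝟙-yes Qr₀ (Q? (suc M)))
  ... | no r₀≢1+M = cong₂ _+_ (sumFrom1-𝟙-unique M r₀>0 (ℕₚ.≤-pred (ℕₚ.≤∧≢⇒< r₀≤1+M r₀≢1+M)) Qr₀ only-r₀)
                              (𝟙-no (λ Q1+M → r₀≢1+M (≡.sym (only-r₀ Q1+M))) (Q? (suc M)))

-- Least periods of an arbitrary map f on a finite field.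
module PeriodicPoints (F : FiniteField) (f : FiniteField.Carrier F → FiniteField.Carrier F) where
  open FiniteField F using (_≈_; _≟_)

  period-unique : ∀ {r r′ x} → IsPeriodicPoint F f r x → IsPeriodicPoint F f r′ x → r ≡ r′
  period-unique {r} {r′} (r>0 , fʳx≈x , r-least) (r′>0 , fʳ′x≈x , r′-least) with ℕₚ.<-cmp r r′
  ... | tri< r<r′ _ _ = ⊥-elim (r′-least r r<r′ r>0 fʳx≈x)
  ... | tri≈ _ r≡r′ _ = r≡r′
  ... | tri> _ _ r′<r = ⊥-elim (r-least r′ r′<r r′>0 fʳ′x≈x)

  first-return : ∀ x N → (∀ r → 0 < r → r ≤ N → ¬ iterate F f r x ≈ x)
                       ⊎ ∃ λ r → r ≤ N × IsPeriodicPoint F f r x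
  first-return x zero = inj₁ λ { _ (s≤s _) () }
  first-return x (suc N) with first-return x N
  ... | inj₂ (r , r≤N , periodic) = inj₂ (r , ℕₚ.m≤n⇒m≤1+n r≤N , periodic)
  ... | inj₁ no-return with iterate F f (suc N) x ≟ x
  ...   | yes returns = inj₂ (suc N , ℕₚ.≤-refl , s≤s z≤n , returns ,
                              λ s s≤N s>0 → no-return s s>0 (ℕₚ.≤-pred s≤N))
  ...   | no ¬returns = inj₁ λ r r>0 r≤1+N →
          [ (λ r<1+N → no-return r r>0 (ℕₚ.≤-pred r<1+N))
          , (λ r≡1+N returns → ¬returns (subst (λ s → iterate F f s x ≈ x) r≡1+N returns)) ]
          (ℕₚ.m≤n⇒m<n∨m≡n r≤1+N)

  least-period : ∀ x R → 0 < R → iterate F f R x ≈ x → ∃ λ r → r ≤ R × IsPeriodicPoint F f r x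
  least-period x R R>0 returns =
    [ (λ no-return → ⊥-elim (no-return R R>0 ℕₚ.≤-refl returns)) , id ]′ (first-return x R)

  periods-of-returning : ∀ x M R → 0 < R → R ≤ M → iterate F f R x ≈ x →
                         sumFrom1 M (λ r → 𝟙 (isPeriodicPoint? F f r x)) ≡ 1
  periods-of-returning x M R R>0 R≤M returns with least-period x R R>0 returns
  ... | r , r≤R , periodic =
    sumFrom1-𝟙-unique (λ s → isPeriodicPoint? F f s x) M (proj₁ periodic) (ℕₚ.≤-trans r≤R R≤M)
                      periodic (λ periodic′ → period-unique periodic′ periodic)

  periods-of-nonreturning : ∀ x M → (∀ r → 0 < r → ¬ iterate F f r x ≈ x) →
                            sumFrom1 M (λ r → 𝟙 (isPeriodicPoint? F f r x)) ≡ 0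
  periods-of-nonreturning x M never =
    sumFrom1-𝟙-none (λ s → isPeriodicPoint? F f s x) M
                    (λ r r>0 _ periodic → never r r>0 (proj₁ (proj₂ periodic)))

-- Algebra in a finite field: no zero divisors, Fermat's little theorem, the
-- root bound for monic polynomials, and the number of roots of unity.
module FieldTheory (F : FiniteField) where
  open FiniteField F hiding (zero)
    renaming (_+_ to _⊕_; refl to ≈-refl; sym to ≈-sym; trans to ≈-trans)
  open import Relation.Binary.Reasoning.Setoid setoid
  open import Algebra.Properties.CommutativeSemiring.Exp commutativeSemiring
    using (_^_; ^-congˡ; ^-congʳ; ^-homo-*; ^-assocʳ)
  open import Algebra.Properties.Ring ring using (x∙y⁻¹≈ε⇒x≈y; +-identityˡ-unique)
  open import Algebra.Properties.CommutativeSemigroup *-commutativeSemigroup using (interchange; x∙yz≈y∙xz)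
  open import Algebra.Properties.CommutativeMonoid.Sum *-commutativeMonoid
    using () renaming (sum to ∏; sum-permute to ∏-permute)
  open import Algebra.Solver.Ring.NaturalCoefficients commutativeSemiring (λ _ _ → nothing)
    using (solve; _:=_; _:+_; _:*_; con)

  pow≡^ : ∀ x k → pow F x k ≡ x ^ k
  pow≡^ x zero    = refl
  pow≡^ x (suc k) = cong (x *_) (pow≡^ x k)

  *-cancelˡ-nonzero : ∀ {x y z} → x ≉ 0# → x * y ≈ x * z → y ≈ z
  *-cancelˡ-nonzero {x} {y} {z} x≉0 xy≈xz = begin
    y              ≈⟨ *-identityˡ y ⟨
    1# * y         ≈⟨ *-congʳ x⁻¹x≈1 ⟨
    (x⁻¹ * x) * y  ≈⟨ *-assoc x⁻¹ x y ⟩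
    x⁻¹ * (x * y)  ≈⟨ *-congˡ xy≈xz ⟩
    x⁻¹ * (x * z)  ≈⟨ *-assoc x⁻¹ x z ⟨
    (x⁻¹ * x) * z  ≈⟨ *-congʳ x⁻¹x≈1 ⟩
    1# * z         ≈⟨ *-identityˡ z ⟩
    z              ∎
    where
    x⁻¹ : Carrier
    x⁻¹ = proj₁ (inverse x x≉0)
    x⁻¹x≈1 : x⁻¹ * x ≈ 1#
    x⁻¹x≈1 = ≈-trans (*-comm x⁻¹ x) (proj₂ (inverse x x≉0))

  zero-product : ∀ {x y} → x * y ≈ 0# → x ≈ 0# ⊎ y ≈ 0#
  zero-product {x} {y} xy≈0 with x ≟ 0#
  ... | yes x≈0 = inj₁ x≈0
  ... | no  x≉0 = inj₂ (*-cancelˡ-nonzero x≉0 (≈-trans xy≈0 (≈-sym (zeroʳ x))))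

  *-nonzero : ∀ {x y} → x ≉ 0# → y ≉ 0# → x * y ≉ 0#
  *-nonzero x≉0 y≉0 xy≈0 = [ x≉0 , y≉0 ] (zero-product xy≈0)

  1^k≈1 : ∀ k → 1# ^ k ≈ 1#
  1^k≈1 zero    = ≈-refl
  1^k≈1 (suc k) = ≈-trans (*-identityˡ _) (1^k≈1 k)

  0^k≈0 : ∀ k → 0 < k → 0# ^ k ≈ 0#
  0^k≈0 (suc k) _ = zeroˡ _

  ^≈1-∣ : ∀ {x d e} → d ∣ e → x ^ d ≈ 1# → x ^ e ≈ 1#
  ^≈1-∣ {x} {d} (divides k refl) xᵈ≈1 = begin
    x ^ (k ℕ.* d)  ≡⟨ cong (x ^_) (ℕₚ.*-comm k d) ⟩
    x ^ (d ℕ.* k)  ≈⟨ ^-assocʳ x d k ⟨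
    (x ^ d) ^ k    ≈⟨ ^-congˡ k xᵈ≈1 ⟩
    1# ^ k         ≈⟨ 1^k≈1 k ⟩
    1#             ∎

  ^≈1-cancel : ∀ {x} g c → x ^ c ≈ 1# → x ^ (g + c) ≈ 1# → x ^ g ≈ 1#
  ^≈1-cancel {x} g c xᶜ≈1 xᵍ⁺ᶜ≈1 = begin
    x ^ g          ≈⟨ *-identityʳ _ ⟨
    x ^ g * 1#     ≈⟨ *-congˡ xᶜ≈1 ⟨
    x ^ g * x ^ c  ≈⟨ ^-homo-* x g c ⟨
    x ^ (g + c)    ≈⟨ xᵍ⁺ᶜ≈1 ⟩
    1#             ∎

  ^≈1-gcd : ∀ {x} a b → x ^ a ≈ 1# → x ^ b ≈ 1# → x ^ gcd a b ≈ 1#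
  ^≈1-gcd {x} a b xᵃ≈1 xᵇ≈1 with Bézout.identity (gcd-GCD a b)
  ... | Bézout.+- u v eq = ^≈1-cancel (gcd a b) (v ℕ.* b) (^≈1-∣ (n∣m*n v) xᵇ≈1)
                             (≈-trans (^-congʳ x eq) (^≈1-∣ (n∣m*n u) xᵃ≈1))
  ... | Bézout.-+ u v eq = ^≈1-cancel (gcd a b) (u ℕ.* a) (^≈1-∣ (n∣m*n u) xᵃ≈1)
                             (≈-trans (^-congʳ x eq) (^≈1-∣ (n∣m*n v) xᵇ≈1))

  index : Carrier → Fin size
  index x = proj₁ (enum-surjective x)

  enum-index : ∀ x → enum (index x) ≈ x
  enum-index x = proj₂ (enum-surjective x)

  index-permutation : (g h : Carrier → Carrier) →
                      (∀ {x y} → x ≈ y → g x ≈ g y) → (∀ {x y} → x ≈ y → h x ≈ h y) →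
                      (∀ x → g (h x) ≈ x) → (∀ x → h (g x) ≈ x) →
                      Σ (Permutation size size) λ π → ∀ i → enum (π ⟨$⟩ʳ i) ≈ g (enum i)
  index-permutation g h g-cong h-cong g∘h≈id h∘g≈id =
    permutation (index ∘ g ∘ enum) (index ∘ h ∘ enum) g∘h-on-indices h∘g-on-indices ,
    λ i → enum-index (g (enum i))
    where
    g∘h-on-indices : ∀ j → index (g (enum (index (h (enum j))))) ≡ j
    g∘h-on-indices j = enum-injective _ _
      (≈-trans (enum-index _) (≈-trans (g-cong (enum-index _)) (g∘h≈id (enum j))))
    h∘g-on-indices : ∀ j → index (h (enum (index (g (enum j))))) ≡ j
    h∘g-on-indices j = enum-injective _ _
      (≈-trans (enum-index _) (≈-trans (h-cong (enum-index _)) (h∘g≈id (enum j))))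

  ∏-scale : ∀ x {n} {P : Fin n → Set ℓᵖ} (P? : ∀ i → Dec (P i)) (f g : Fin n → Carrier) →
            (∀ i → P i → g i ≈ x * f i) → (∀ i → ¬ P i → g i ≈ f i) → ∏ g ≈ x ^ count P? * ∏ f
  ∏-scale x {zero}  P? f g scaled fixed = ≈-sym (*-identityˡ 1#)
  ∏-scale x {suc n} P? f g scaled fixed
    with P? zero | ∏-scale x (P? ∘ suc) (f ∘ suc) (g ∘ suc) (scaled ∘ suc) (fixed ∘ suc)
  ... | yes P0 | rest = ≈-trans (*-cong (scaled zero P0) rest) (interchange _ _ _ _)
  ... | no ¬P0 | rest = ≈-trans (*-cong (fixed zero ¬P0) rest) (x∙yz≈y∙xz _ _ _)

  ∏-nonzero : ∀ {n} (g : Fin n → Carrier) → (∀ i → g i ≉ 0#) → ∏ g ≉ 0#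
  ∏-nonzero {zero}  g g≉0 = 1≉0
  ∏-nonzero {suc n} g g≉0 = *-nonzero (g≉0 zero) (∏-nonzero (g ∘ suc) (g≉0 ∘ suc))

  -- x with 0 replaced by 1; the product of nonzeroPart over F is ∏ F*.
  nonzeroPart : Carrier → Carrier
  nonzeroPart y with y ≟ 0#
  ... | yes _ = 1#
  ... | no _  = y

  nonzeroPart-≉0 : ∀ y → nonzeroPart y ≉ 0#
  nonzeroPart-≉0 y with y ≟ 0#
  ... | yes _   = 1≉0
  ... | no  y≉0 = y≉0

  nonzeroPart-of-0 : ∀ {y} → y ≈ 0# → nonzeroPart y ≈ 1#
  nonzeroPart-of-0 {y} y≈0 with y ≟ 0#
  ... | yes _   = ≈-refl
  ... | no  y≉0 = ⊥-elim (y≉0 y≈0)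

  nonzeroPart-of-unit : ∀ {y} → y ≉ 0# → nonzeroPart y ≈ y
  nonzeroPart-of-unit {y} y≉0 with y ≟ 0#
  ... | yes y≈0 = ⊥-elim (y≉0 y≈0)
  ... | no  _   = ≈-refl

  units : ℕ
  units = count (λ i → ¬? (enum i ≟ 0#))

  -- Fermat's little theorem: x^#F* = 1 for x ≠ 0.  Multiplication by x
  -- permutes F*, so ∏ F* = x^#F* · ∏ F*, and ∏ F* ≠ 0 cancels.
  fermat : ∀ {x} → x ≉ 0# → x ^ units ≈ 1#
  fermat {x} x≉0 = *-cancelˡ-nonzero (∏-nonzero nz (nonzeroPart-≉0 ∘ enum)) (begin
    ∏ nz * x ^ units         ≈⟨ *-comm _ _ ⟩
    x ^ units * ∏ nz         ≈⟨ ∏-scale x (λ i → ¬? (enum i ≟ 0#)) nz (nz ∘ (π ⟨$⟩ʳ_)) scaled fixed ⟨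
    ∏ (nz ∘ (π ⟨$⟩ʳ_))       ≈⟨ ∏-permute nz π ⟨
    ∏ nz                     ≈⟨ *-identityʳ _ ⟨
    ∏ nz * 1#                ∎)
    where
    nz : Fin size → Carrier
    nz = nonzeroPart ∘ enum
    x⁻¹ : Carrier
    x⁻¹ = proj₁ (inverse x x≉0)
    x*x⁻¹≈1 : x * x⁻¹ ≈ 1#
    x*x⁻¹≈1 = proj₂ (inverse x x≉0)
    multiplication-by-x : Σ (Permutation size size) λ π → ∀ i → enum (π ⟨$⟩ʳ i) ≈ x * enum i
    multiplication-by-x = index-permutation (x *_) (x⁻¹ *_) *-congˡ *-congˡ
      (λ y → ≈-trans (≈-sym (*-assoc _ _ _)) (≈-trans (*-congʳ x*x⁻¹≈1) (*-identityˡ y)))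
      (λ y → ≈-trans (≈-sym (*-assoc _ _ _))
               (≈-trans (*-congʳ (≈-trans (*-comm _ _) x*x⁻¹≈1)) (*-identityˡ y)))
    π : Permutation size size
    π = proj₁ multiplication-by-x
    π-spec : ∀ i → enum (π ⟨$⟩ʳ i) ≈ x * enum i
    π-spec = proj₂ multiplication-by-x
    scaled : ∀ i → enum i ≉ 0# → nz (π ⟨$⟩ʳ i) ≈ x * nz i
    scaled i eᵢ≉0 = begin
      nonzeroPart (enum (π ⟨$⟩ʳ i))  ≈⟨ nonzeroPart-of-unit xeᵢ≉0 ⟩
      enum (π ⟨$⟩ʳ i)                ≈⟨ π-spec i ⟩
      x * enum i                     ≈⟨ *-congˡ (nonzeroPart-of-unit eᵢ≉0) ⟨
      x * nonzeroPart (enum i)       ∎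
      where
      xeᵢ≉0 : enum (π ⟨$⟩ʳ i) ≉ 0#
      xeᵢ≉0 e≈0 = *-nonzero x≉0 eᵢ≉0 (≈-trans (≈-sym (π-spec i)) e≈0)
    fixed : ∀ i → ¬ enum i ≉ 0# → nz (π ⟨$⟩ʳ i) ≈ nz i
    fixed i ¬eᵢ≉0 = ≈-trans (nonzeroPart-of-0 (≈-trans (π-spec i) (≈-trans (*-congˡ eᵢ≈0) (zeroʳ x))))
                            (≈-sym (nonzeroPart-of-0 eᵢ≈0))
      where
      eᵢ≈0 : enum i ≈ 0#
      eᵢ≈0 = decidable-stable (enum i ≟ 0#) ¬eᵢ≉0

  count-zero : count (λ i → enum i ≟ 0#) ≡ 1
  count-zero = ≡.trans (count-cong (λ i → enum i ≟ 0#) (Finₚ._≟ index 0#)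
                          (λ i eᵢ≈0 → enum-injective i (index 0#) (≈-trans eᵢ≈0 (≈-sym (enum-index 0#))))
                          (λ { i refl → enum-index 0# }))
                       (count-≡ (index 0#))

  units≡size∸1 : units ≡ size ∸ 1
  units≡size∸1 = cong (_∸ 1) (≡.trans (cong (_+ units) (≡.sym count-zero))
                                      (count-complement (λ i → enum i ≟ 0#)))

  units-positive : 0 < units
  units-positive = ℕₚ.≤-trans (ℕₚ.≤-reflexive (≡.sym (count-≡ (index 1#))))
                     (count-mono (Finₚ._≟ index 1#) (λ i → ¬? (enum i ≟ 0#))
                       (λ { i refl e₁≈0 → 1≉0 (≈-trans (≈-sym (enum-index 1#)) e₁≈0) }))

  -- The monic polynomial c₀ + c₁y + … + c_{k-1}y^(k-1) + y^k of degree k,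
  -- represented by the list [c₀, …, c_{k-1}] of its lower coefficients.
  evalMonic : List Carrier → Carrier → Carrier
  evalMonic []       y = 1#
  evalMonic (c ∷ cs) y = c ⊕ y * evalMonic cs y

  evalMonic-cong : ∀ cs {y z} → y ≈ z → evalMonic cs y ≈ evalMonic cs z
  evalMonic-cong []       y≈z = ≈-refl
  evalMonic-cong (c ∷ cs) y≈z = +-congˡ (*-cong y≈z (evalMonic-cong cs y≈z))

  -- Division with remainder by y - a, written in the shifted variable d = y - a.
  divide : ∀ a c cs → Σ (List Carrier) λ qs → Σ Carrier λ ρ →
           length qs ≡ length cs × (∀ d → evalMonic (c ∷ cs) (d ⊕ a) ≈ d * evalMonic qs (d ⊕ a) ⊕ ρ)
  divide a c [] = [] , c ⊕ a , refl ,
    λ d → solve 3 (λ c d a → c :+ (d :+ a) :* con 1 := d :* con 1 :+ (c :+ a)) ≈-refl c d a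
  divide a c (c′ ∷ cs) with divide a c′ cs
  ... | qs , ρ , length-qs , division = ρ ∷ qs , c ⊕ a * ρ , cong suc length-qs ,
    λ d → ≈-trans (+-congˡ (*-congˡ (division d)))
            (solve 5 (λ c d a Q ρ → c :+ (d :+ a) :* (d :* Q :+ ρ)
                                 := d :* (ρ :+ (d :+ a) :* Q) :+ (c :+ a :* ρ))
                   ≈-refl c d a (evalMonic qs (d ⊕ a)) ρ)

  y-a+a≈y : ∀ y a → (y - a) ⊕ a ≈ y
  y-a+a≈y y a = begin
    (y - a) ⊕ a    ≈⟨ +-assoc y (- a) a ⟩
    y ⊕ (- a ⊕ a)  ≈⟨ +-congˡ (-‿inverseˡ a) ⟩
    y ⊕ 0#         ≈⟨ +-identityʳ y ⟩
    y              ∎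

  factor-root : ∀ a c cs → evalMonic (c ∷ cs) a ≈ 0# →
                Σ (List Carrier) λ qs → length qs ≡ length cs ×
                                       (∀ y → evalMonic (c ∷ cs) y ≈ (y - a) * evalMonic qs y)
  factor-root a c cs root with divide a c cs
  ... | qs , ρ , length-qs , division = qs , length-qs , factored
    where
    ρ≈0 : ρ ≈ 0#
    ρ≈0 = begin
      ρ                                ≈⟨ +-identityˡ ρ ⟨
      0# ⊕ ρ                           ≈⟨ +-congʳ (zeroˡ _) ⟨
      0# * evalMonic qs (0# ⊕ a) ⊕ ρ   ≈⟨ division 0# ⟨
      evalMonic (c ∷ cs) (0# ⊕ a)      ≈⟨ evalMonic-cong (c ∷ cs) (+-identityˡ a) ⟩
      evalMonic (c ∷ cs) a             ≈⟨ root ⟩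
      0#                               ∎
    factored : ∀ y → evalMonic (c ∷ cs) y ≈ (y - a) * evalMonic qs y
    factored y = begin
      evalMonic (c ∷ cs) y                         ≈⟨ evalMonic-cong (c ∷ cs) (y-a+a≈y y a) ⟨
      evalMonic (c ∷ cs) ((y - a) ⊕ a)             ≈⟨ division (y - a) ⟩
      (y - a) * evalMonic qs ((y - a) ⊕ a) ⊕ ρ     ≈⟨ +-cong (*-congˡ (evalMonic-cong qs (y-a+a≈y y a))) ρ≈0 ⟩
      (y - a) * evalMonic qs y ⊕ 0#                ≈⟨ +-identityʳ _ ⟩
      (y - a) * evalMonic qs y                     ∎

  roots : List Carrier → ℕ
  roots cs = count (λ i → evalMonic cs (enum i) ≟ 0#)

  roots≤degree : ∀ {k} cs → length cs ≡ k → roots cs ≤ k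
  roots≤degree [] refl = ℕₚ.≤-reflexive (count-none (λ i → evalMonic [] (enum i) ≟ 0#) (λ i → 1≉0))
  roots≤degree {suc k} (c ∷ cs) length≡ with Finₚ.any? (λ i → evalMonic (c ∷ cs) (enum i) ≟ 0#)
  ... | no no-root = ℕₚ.≤-trans (ℕₚ.≤-reflexive no-roots) z≤n
    where
    no-roots : roots (c ∷ cs) ≡ 0
    no-roots = count-none (λ i → evalMonic (c ∷ cs) (enum i) ≟ 0#) (λ i root → no-root (i , root))
  ... | yes (j , root) with factor-root (enum j) c cs root
  ...   | qs , length-qs , factored =
    ℕₚ.≤-trans (count-cover (λ i → evalMonic (c ∷ cs) (enum i) ≟ 0#) (Finₚ._≟ j)
                            (λ i → evalMonic qs (enum i) ≟ 0#) j-or-root-of-qs)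
               (ℕₚ.+-mono-≤ (ℕₚ.≤-reflexive (count-≡ j))
                            (roots≤degree qs (≡.trans length-qs (ℕₚ.suc-injective length≡))))
    where
    j-or-root-of-qs : ∀ i → evalMonic (c ∷ cs) (enum i) ≈ 0# → i ≡ j ⊎ evalMonic qs (enum i) ≈ 0#
    j-or-root-of-qs i root-i =
      Sum.map₁ (λ d≈0 → enum-injective i j (x∙y⁻¹≈ε⇒x≈y _ _ d≈0))
               (zero-product (≈-trans (≈-sym (factored (enum i))) root-i))

  evalMonic-shift : ∀ k cs y → evalMonic (replicate k 0# ++ cs) y ≈ y ^ k * evalMonic cs y
  evalMonic-shift zero    cs y = ≈-sym (*-identityˡ _)
  evalMonic-shift (suc k) cs y = begin
    0# ⊕ y * evalMonic (replicate k 0# ++ cs) y  ≈⟨ +-identityˡ _ ⟩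
    y * evalMonic (replicate k 0# ++ cs) y       ≈⟨ *-congˡ (evalMonic-shift k cs y) ⟩
    y * (y ^ k * evalMonic cs y)                 ≈⟨ *-assoc y (y ^ k) _ ⟨
    y * y ^ k * evalMonic cs y                   ∎

  -- The polynomial y^(k+1) - 1.
  unity : ℕ → List Carrier
  unity k = - 1# ∷ replicate k 0#

  root-of-unity⇒root : ∀ k y → y ^ suc k ≈ 1# → evalMonic (unity k) y ≈ 0#
  root-of-unity⇒root k y yᵈ≈1 = begin
    - 1# ⊕ y * evalMonic (replicate k 0#) y             ≡⟨ cong (λ cs → - 1# ⊕ y * evalMonic cs y)
                                                                (++-identityʳ (replicate k 0#)) ⟨
    - 1# ⊕ y * evalMonic (replicate k 0# ++ []) y       ≈⟨ +-congˡ (*-congˡ (evalMonic-shift k [] y)) ⟩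
    - 1# ⊕ y * (y ^ k * 1#)                             ≈⟨ +-congˡ (*-congˡ (*-identityʳ _)) ⟩
    - 1# ⊕ y ^ suc k                                    ≈⟨ +-congˡ yᵈ≈1 ⟩
    - 1# ⊕ 1#                                           ≈⟨ -‿inverseˡ 1# ⟩
    0#                                                  ∎

  -- The polynomial 1 + z + z² + … + z^t in z = y^(k+1), monic of degree t·(k+1).
  geometric : ℕ → ℕ → List Carrier
  geometric k zero    = []
  geometric k (suc t) = 1# ∷ (replicate k 0# ++ geometric k t)

  length-geometric : ∀ k t → length (geometric k t) ≡ t ℕ.* suc k
  length-geometric k zero    = refl
  length-geometric k (suc t) = cong suc (≡.trans (length-++ (replicate k 0#))
                                                  (cong₂ _+_ (length-replicate k) (length-geometric k t)))

  geometric-sum : ∀ k t y w → w ⊕ 1# ≈ y ^ suc k →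
                  w * evalMonic (geometric k t) y ⊕ 1# ≈ (w ⊕ 1#) ^ suc t
  geometric-sum k zero    y w w+1≈z = solve 1 (λ w → w :* con 1 :+ con 1 := (w :+ con 1) :* con 1) ≈-refl w
  geometric-sum k (suc t) y w w+1≈z = begin
    w * (1# ⊕ y * evalMonic (replicate k 0# ++ geometric k t) y) ⊕ 1#
      ≈⟨ +-congʳ (*-congˡ (+-congˡ (*-congˡ (evalMonic-shift k (geometric k t) y)))) ⟩
    w * (1# ⊕ y * (y ^ k * S)) ⊕ 1#
      ≈⟨ +-congʳ (*-congˡ (+-congˡ (≈-trans (≈-sym (*-assoc y (y ^ k) S)) (*-congʳ (≈-sym w+1≈z))))) ⟩
    w * (1# ⊕ (w ⊕ 1#) * S) ⊕ 1#
      ≈⟨ solve 2 (λ w S → w :* (con 1 :+ (w :+ con 1) :* S) :+ con 1 := (w :+ con 1) :* (w :* S :+ con 1))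
                 ≈-refl w S ⟩
    (w ⊕ 1#) * (w * S ⊕ 1#)
      ≈⟨ *-congˡ (geometric-sum k t y w w+1≈z) ⟩
    (w ⊕ 1#) * (w ⊕ 1#) ^ suc t
      ∎
    where
    S : Carrier
    S = evalMonic (geometric k t) y

  rootOfUnity? : ∀ d x → Dec (x ^ d ≈ 1#)
  rootOfUnity? d x = (x ^ d) ≟ 1#

  -- At most d elements satisfy x^d = 1 (d > 0): they are roots of y^d - 1.
  roots-of-unity≤ : ∀ d → 0 < d → count (rootOfUnity? d ∘ enum) ≤ d
  roots-of-unity≤ (suc k) _ =
    ℕₚ.≤-trans (count-mono (rootOfUnity? (suc k) ∘ enum) (λ i → evalMonic (unity k) (enum i) ≟ 0#)
                           (λ i → root-of-unity⇒root k (enum i)))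
               (roots≤degree (unity k) (cong suc (length-replicate k)))

  -- If d ∣ #F* (d > 0) then at least d elements satisfy x^d = 1: writing
  -- #F* = (t+1)·d, every unit is a root of y^d - 1 or of 1 + y^d + … + y^(td).
  roots-of-unity≥ : ∀ d → 0 < d → d ∣ units → d ≤ count (rootOfUnity? d ∘ enum)
  roots-of-unity≥ (suc k) _ (divides zero units≡0) = ⊥-elim (ℕₚ.<⇒≢ units-positive (≡.sym units≡0))
  roots-of-unity≥ (suc k) _ (divides (suc t) units≡) = ℕₚ.+-cancelʳ-≤ (t ℕ.* suc k) (suc k) _
    (ℕₚ.≤-trans (ℕₚ.≤-reflexive (≡.sym units≡))
    (ℕₚ.≤-trans (count-cover (λ i → ¬? (enum i ≟ 0#)) (rootOfUnity? (suc k) ∘ enum)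
                             (λ i → evalMonic (geometric k t) (enum i) ≟ 0#) unit-splits)
                (ℕₚ.+-monoʳ-≤ _ (roots≤degree (geometric k t) (length-geometric k t)))))
    where
    unit-splits : ∀ i → enum i ≉ 0# → enum i ^ suc k ≈ 1# ⊎ evalMonic (geometric k t) (enum i) ≈ 0#
    unit-splits i eᵢ≉0 = Sum.map₁ (x∙y⁻¹≈ε⇒x≈y _ _) (zero-product (+-identityˡ-unique _ _ telescoped))
      where
      x z : Carrier
      x = enum i
      z = x ^ suc k
      telescoped : (z - 1#) * evalMonic (geometric k t) x ⊕ 1# ≈ 1#
      telescoped = begin
        (z - 1#) * evalMonic (geometric k t) x ⊕ 1#  ≈⟨ geometric-sum k t x (z - 1#) (y-a+a≈y z 1#) ⟩
        ((z - 1#) ⊕ 1#) ^ suc t                      ≈⟨ ^-congˡ (suc t) (y-a+a≈y z 1#) ⟩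
        z ^ suc t                                    ≈⟨ ^-assocʳ x (suc k) (suc t) ⟩
        x ^ (suc k ℕ.* suc t)                        ≡⟨ cong (x ^_) (≡.trans (ℕₚ.*-comm (suc k) (suc t))
                                                                             (≡.sym units≡)) ⟩
        x ^ units                                    ≈⟨ fermat eᵢ≉0 ⟩
        1#                                           ∎

  roots-of-unity : ∀ d → 0 < d → d ∣ units → count (rootOfUnity? d ∘ enum) ≡ d
  roots-of-unity d d>0 d∣units = ℕₚ.≤-antisym (roots-of-unity≤ d d>0) (roots-of-unity≥ d d>0 d∣units)

coprime-∣ : ∀ {d e n} → d ∣ e → Coprime e n → Coprime d n
coprime-∣ d∣e e⊥n (i∣d , i∣n) = e⊥n (∣-trans i∣d d∣e , i∣n)

coprime-* : ∀ {a b n} → Coprime a n → Coprime b n → Coprime (a ℕ.* b) n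
coprime-* {a} {b} {n} a⊥n b⊥n {i} (i∣ab , i∣n) = b⊥n (coprime-divisor i⊥a i∣ab , i∣n)
  where
  i⊥a : Coprime i a
  i⊥a = gcd≡1⇒coprime (a⊥n (gcd[m,n]∣n i a , ∣-trans (gcd[m,n]∣m i a) i∣n))

-- Every divisor of m > 0 coprime to n divides the largest such divisor q:
-- lcm(d, q) is again such a divisor, so it is at most q, hence equal to q.
∣-largestCoprimeDivisor : ∀ {m n q d} → 0 < m → IsLargestCoprimeDivisor m n q →
                          d ∣ m → Coprime d n → d ∣ q
∣-largestCoprimeDivisor {m} {n} {q} {d} m>0 (q∣m , q⊥n , q-largest) d∣m d⊥n =
  subst (d ∣_) lcm≡q (m∣lcm[m,n] d q)
  where
  lcm∣m : lcm d q ∣ m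
  lcm∣m = lcm-least d∣m q∣m
  lcm⊥n : Coprime (lcm d q) n
  lcm⊥n = coprime-∣ (divides (gcd d q) (≡.sym (gcd*lcm d q))) (coprime-* d⊥n q⊥n)
  lcm≢0 : lcm d q ≢ 0
  lcm≢0 lcm≡0 = ℕₚ.<⇒≢ m>0 (≡.sym (0∣⇒≡0 (subst (_∣ m) lcm≡0 lcm∣m)))
  lcm≡q : lcm d q ≡ q
  lcm≡q = ℕₚ.≤-antisym (q-largest _ lcm∣m lcm⊥n) (∣⇒≤ {{ℕ.≢-nonZero lcm≢0}} (n∣lcm[m,n] d q))

pow∸1+1≡pow : ∀ {n} r → 1 ≤ n → (n ℕ.^ r ∸ 1) + 1 ≡ n ℕ.^ r
pow∸1+1≡pow {n} r n≥1 = ℕₚ.m∸n+n≡m (ℕₚ.m^n>0 n {{ℕ.>-nonZero n≥1}} r)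

pow∸1-coprime : ∀ {n} r → 1 ≤ n → 0 < r → Coprime (n ℕ.^ r ∸ 1) n
pow∸1-coprime {n} (suc r) n≥1 _ {i} (i∣nʳ∸1 , i∣n) = ∣1⇒≡1 (∣m+n∣m⇒∣n i∣nʳ i∣nʳ∸1)
  where
  i∣nʳ : i ∣ (n ℕ.^ suc r ∸ 1) + 1
  i∣nʳ = subst (i ∣_) (≡.sym (pow∸1+1≡pow (suc r) n≥1)) (∣-trans i∣n (m∣m*n (n ℕ.^ r)))

module PowerMap (F : FiniteField) (n : ℕ) (n≥1 : 1 ≤ n) where
  open FiniteField F
    using (Carrier; _≈_; _≉_; _*_; 0#; 1#; setoid; commutativeSemiring; zeroˡ; *-identityʳ; *-congˡ; *-congʳ)
    renaming (sym to ≈-sym; trans to ≈-trans)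
  open FieldTheory F
  open import Relation.Binary.Reasoning.Setoid setoid
  open import Algebra.Properties.CommutativeSemiring.Exp commutativeSemiring
    using (_^_; ^-congˡ; ^-congʳ; ^-assocʳ)

  f : Carrier → Carrier
  f = powerMap F n

  iterate-powerMap : ∀ r x → iterate F f r x ≈ x ^ (n ℕ.^ r)
  iterate-powerMap zero    x = ≈-sym (*-identityʳ x)
  iterate-powerMap (suc r) x = begin
    pow F (iterate F f r x) n  ≡⟨ pow≡^ _ n ⟩
    iterate F f r x ^ n        ≈⟨ ^-congˡ n (iterate-powerMap r x) ⟩
    (x ^ (n ℕ.^ r)) ^ n        ≈⟨ ^-assocʳ x (n ℕ.^ r) n ⟩
    x ^ (n ℕ.^ r ℕ.* n)        ≡⟨ cong (x ^_) (ℕₚ.*-comm (n ℕ.^ r) n) ⟩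
    x ^ (n ℕ.^ suc r)          ∎

  iterate-powerMap′ : ∀ r x → iterate F f r x ≈ x * x ^ (n ℕ.^ r ∸ 1)
  iterate-powerMap′ r x = ≈-trans (iterate-powerMap r x)
    (^-congʳ x (≡.trans (≡.sym (pow∸1+1≡pow r n≥1)) (ℕₚ.+-comm _ 1)))

  returns⇒^≈1 : ∀ {r x} → x ≉ 0# → iterate F f r x ≈ x → x ^ (n ℕ.^ r ∸ 1) ≈ 1#
  returns⇒^≈1 {r} {x} x≉0 returns =
    *-cancelˡ-nonzero x≉0 (≈-trans (≈-sym (iterate-powerMap′ r x))
                                   (≈-trans returns (≈-sym (*-identityʳ x))))

  ^≈1⇒returns : ∀ {r x} → x ≈ 0# ⊎ x ^ (n ℕ.^ r ∸ 1) ≈ 1# → iterate F f r x ≈ x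
  ^≈1⇒returns {r} {x} (inj₁ x≈0) = ≈-trans (iterate-powerMap′ r x)
    (≈-trans (*-congʳ x≈0) (≈-trans (zeroˡ _) (≈-sym x≈0)))
  ^≈1⇒returns {r} {x} (inj₂ root) = ≈-trans (iterate-powerMap′ r x)
    (≈-trans (*-congˡ root) (*-identityʳ x))

module Setting (F : FiniteField) (n : ℕ) (n≥1 : 1 ≤ n) (qStar rHat : ℕ)
               (qStar-largest : IsLargestCoprimeDivisor (FiniteField.size F ∸ 1) n qStar)
               (rHat-least : IsLeastOrder qStar n rHat) where
  open FiniteField F using (_≈_; _≉_; _≟_; 0#; 1#; 1≉0; setoid; commutativeSemiring)
  open FieldTheory F
  open PowerMap F n n≥1
  open PeriodicPoints F f
  open import Relation.Binary.Reasoning.Setoid setoid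
  open import Algebra.Properties.CommutativeSemiring.Exp commutativeSemiring using (_^_; ^-congˡ)

  qStar-largest′ : IsLargestCoprimeDivisor units n qStar
  qStar-largest′ = subst (λ m → IsLargestCoprimeDivisor m n qStar) (≡.sym units≡size∸1) qStar-largest

  qStar∣units : qStar ∣ units
  qStar∣units = proj₁ qStar-largest′

  qStar-positive : 0 < qStar
  qStar-positive = ℕₚ.n≢0⇒n>0 λ qStar≡0 →
    ℕₚ.<⇒≢ units-positive (≡.sym (0∣⇒≡0 (subst (_∣ units) qStar≡0 qStar∣units)))

  -- A nonzero point returning after r > 0 steps is a q*-th root of unity:
  -- x^(nʳ-1) = 1 and x^#F* = 1, and gcd(nʳ - 1, #F*) divides q*.
  returns⇒root : ∀ {r x} → x ≉ 0# → 0 < r → iterate F f r x ≈ x → x ^ qStar ≈ 1#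
  returns⇒root {r} x≉0 r>0 returns =
    ^≈1-∣ gcd∣qStar (^≈1-gcd (n ℕ.^ r ∸ 1) units (returns⇒^≈1 {r} x≉0 returns) (fermat x≉0))
    where
    gcd∣qStar : gcd (n ℕ.^ r ∸ 1) units ∣ qStar
    gcd∣qStar = ∣-largestCoprimeDivisor units-positive qStar-largest′ (gcd[m,n]∣n (n ℕ.^ r ∸ 1) units)
                  (coprime-∣ (gcd[m,n]∣m _ _) (pow∸1-coprime r n≥1 r>0))

  -- 0 and the q*-th roots of unity return after r̂ steps, since q* ∣ n^r̂ - 1.
  root⇒returns : ∀ {x} → x ≈ 0# ⊎ x ^ qStar ≈ 1# → iterate F f rHat x ≈ x
  root⇒returns = ^≈1⇒returns {rHat} ∘ Sum.map₂ (^≈1-∣ (proj₁ (proj₂ rHat-least)))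

  -- For M ≥ r̂, x has one least period in [1, M] if x = 0 or x^q* = 1 (these
  -- exclude each other, as 0^q* = 0), and none otherwise.
  periods-count : ∀ M → rHat ≤ M → ∀ x →
                  sumFrom1 M (λ r → 𝟙 (isPeriodicPoint? F f r x)) ≡ 𝟙 (x ≟ 0#) + 𝟙 (rootOfUnity? qStar x)
  periods-count M rHat≤M x with x ≟ 0# | rootOfUnity? qStar x
  ... | yes x≈0 | yes root  = ⊥-elim (1≉0 (begin
        1#          ≈⟨ root ⟨
        x ^ qStar   ≈⟨ ^-congˡ qStar x≈0 ⟩
        0# ^ qStar  ≈⟨ 0^k≈0 qStar qStar-positive ⟩
        0#          ∎))
  ... | yes x≈0 | no _      =
    periods-of-returning x M rHat (proj₁ rHat-least) rHat≤M (root⇒returns (inj₁ x≈0))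
  ... | no _    | yes root  =
    periods-of-returning x M rHat (proj₁ rHat-least) rHat≤M (root⇒returns (inj₂ root))
  ... | no x≉0  | no ¬root  =
    periods-of-nonreturning x M (λ r r>0 returns → ¬root (returns⇒root x≉0 r>0 returns))

proposition2p9 : (F : FiniteField) → (n : ℕ) → 2 ≤ n →
    (qStar rHat : ℕ) →
    IsLargestCoprimeDivisor (FiniteField.size F ∸ 1) n qStar →
    IsLeastOrder qStar n rHat →
    (M : ℕ) → rHat ≤ M →
    sumFrom1 M (numPeriodicPoints F (powerMap F n)) ≡ qStar + 1
proposition2p9 F n n≥2 qStar rHat qStar-largest rHat-least M rHat≤M = begin
  sumFrom1 M (numPeriodicPoints F f)
    ≡⟨ sumFrom1-cong M (λ r → length-filter-tabulate (λ i → isPeriodicPoint? F f r (enum i)) id) ⟩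
  sumFrom1 M (λ r → count (λ i → isPeriodicPoint? F f r (enum i)))
    ≡⟨ sumFrom1-∑-comm M (λ r i → 𝟙 (isPeriodicPoint? F f r (enum i))) ⟩
  sum (λ i → sumFrom1 M (λ r → 𝟙 (isPeriodicPoint? F f r (enum i))))
    ≡⟨ sum-cong-≗ (periods-count M rHat≤M ∘ enum) ⟩
  sum (λ i → 𝟙 (enum i ≟ 0#) + 𝟙 (rootOfUnity? qStar (enum i)))
    ≡⟨ ∑-distrib-+ (λ i → 𝟙 (enum i ≟ 0#)) (λ i → 𝟙 (rootOfUnity? qStar (enum i))) ⟩
  count (λ i → enum i ≟ 0#) + count (rootOfUnity? qStar ∘ enum)
    ≡⟨ cong₂ _+_ count-zero (roots-of-unity qStar qStar-positive qStar∣units) ⟩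
  1 + qStar
    ≡⟨ ℕₚ.+-comm 1 qStar ⟩
  qStar + 1
    ∎
  where
  open ≡.≡-Reasoning
  open FiniteField F using (enum; _≟_; 0#)
  open FieldTheory F using (count-zero; rootOfUnity?; roots-of-unity)
  n≥1 : 1 ≤ n
  n≥1 = ℕₚ.<⇒≤ n≥2
  open PowerMap F n n≥1 using (f)
  open Setting F n n≥1 qStar rHat qStar-largest rHat-least using (qStar-positive; qStar∣units; periods-count)
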